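{- Let $\{F_n\}$ be the Fibonacci sequence, defined by $F_0 = 0$, $F_1 = 1$ and $F_n = F_{n-1} + F_{n-2}$ for $n \ge 2$. Then there exist infinitely many positive integers $k$ such that $k(F_n + 5) + 1$ is composite for all integers $n \ge 1$. -}

module Defs where

open import Data.Nat using (ℕ; zero; suc; _+_)

fib : ℕ → ℕ
fib zero = 0
fib (suc zero) = 1
fib (suc (suc n)) = fib (suc n) + fib n

{-# OPTIONS --safe #-}
module Submission where

-- Modulo M = 2·3·5·7·11·23·31·41·61·241·2161·2521·20641 the Fibonacci numbers have
-- period 240, since F₂₄₀ ≡ 0 and F₂₄₁ ≡ 1.  For k₀ below, each of the 240 residues r
-- has a prime p ∣ M dividing k₀ (F_r + 5) + 1 (a covering, checked by computation).
-- If k ≡ k₀ (mod M) and n ≡ r (mod 240) then k (F_n + 5) + 1 ≡ k₀ (F_r + 5) + 1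
-- (mod M), so p divides it, and p ≤ M ≤ k makes p a proper divisor.  The covering
-- includes r = 0.

open import Defs
open import Data.Nat using (ℕ; _+_; _*_; _<_; _≥_)
open import Data.Nat.Primality using (Composite)
open import Data.Product using (∃-syntax; _×_)

open import Data.Nat using (zero; suc; _≤_; _%_; _/_; NonZero; z<s; n>1⇒nonTrivial; ≢-nonZero)
open import Data.Nat.Properties
open import Data.Nat.DivMod using (%-distribˡ-+; %-distribˡ-*; %-remove-+ʳ; m≡m%n+[m/n]*n; m%n<n)
open import Data.Nat.Divisibility using (_∣_; _∣?_; _∣0; ∣⇒≤; ∣m⇒∣m*n; m∣m*n; n∣m⇒m%n≡0; %-presˡ-∣; ∣n∣m%n⇒∣m)
open import Data.Nat.Divisibility.Core using (hasNonTrivialDivisor)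
open import Data.Nat.ListAction using (product)
open import Data.Nat.ListAction.Properties using (∈⇒∣product)
open import Data.Nat.Solver using (module +-*-Solver)
open import Data.List using (List; []; _∷_)
open import Data.List.Relation.Unary.All as All using (All; all?)
open import Data.List.Relation.Unary.Any using (Any; any?)
open import Data.List.Membership.Propositional using (_∈_; find)
open import Data.Fin using (Fin; toℕ; fromℕ<)
open import Data.Fin.Properties as Fin using (toℕ-fromℕ<)
open import Data.Product using (_,_)
open import Function.Strict using (_$!_)
open import Relation.Nullary.Decidable using (from-yes)
open import Relation.Binary.PropositionalEquality

fib-+-suc : ∀ m n → fib (m + suc n) ≡ fib (suc m) * fib (suc n) + fib m * fib n
fib-+-suc zero          n = sym (trans (+-identityʳ _) (*-identityˡ _))
fib-+-suc (suc zero)    n = cong₂ _+_ (sym (*-identityˡ (fib (suc n)))) (sym (*-identityˡ (fib n)))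
fib-+-suc (suc (suc m)) n = begin
  fib (suc m + suc n) + fib (m + suc n)
    ≡⟨ cong₂ _+_ (fib-+-suc (suc m) n) (fib-+-suc m n) ⟩
  (fib (suc (suc m)) * fib (suc n) + fib (suc m) * fib n) + (fib (suc m) * fib (suc n) + fib m * fib n)
    ≡⟨ collect (fib (suc (suc m))) (fib (suc m)) (fib m) (fib (suc n)) (fib n) ⟩
  fib (suc (suc (suc m))) * fib (suc n) + fib (suc (suc m)) * fib n ∎
  where
  open ≡-Reasoning
  open +-*-Solver
  collect : ∀ a b c x y → (a * x + b * y) + (b * x + c * y) ≡ (a + b) * x + (b + c) * y
  collect = solve 5 (λ a b c x y → (a :* x :+ b :* y) :+ (b :* x :+ c :* y)
                                  := (a :+ b) :* x :+ (b :+ c) :* y) refl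

module _ {d : ℕ} .{{_ : NonZero d}} where

  +-cong-% : ∀ {a a′ b b′} → a % d ≡ a′ % d → b % d ≡ b′ % d → (a + b) % d ≡ (a′ + b′) % d
  +-cong-% {a} {a′} {b} {b′} a≡a′ b≡b′ = begin
    (a + b) % d               ≡⟨ %-distribˡ-+ a b d ⟩
    (a % d + b % d) % d       ≡⟨ cong₂ (λ x y → (x + y) % d) a≡a′ b≡b′ ⟩
    (a′ % d + b′ % d) % d     ≡⟨ %-distribˡ-+ a′ b′ d ⟨
    (a′ + b′) % d             ∎
    where open ≡-Reasoning

  *-cong-% : ∀ {a a′ b b′} → a % d ≡ a′ % d → b % d ≡ b′ % d → (a * b) % d ≡ (a′ * b′) % d
  *-cong-% {a} {a′} {b} {b′} a≡a′ b≡b′ = begin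
    (a * b) % d               ≡⟨ %-distribˡ-* a b d ⟩
    (a % d * (b % d)) % d     ≡⟨ cong₂ (λ x y → (x * y) % d) a≡a′ b≡b′ ⟩
    (a′ % d * (b′ % d)) % d   ≡⟨ %-distribˡ-* a′ b′ d ⟨
    (a′ * b′) % d             ∎
    where open ≡-Reasoning

  ∣-resp-≡-% : ∀ {p m n} → p ∣ d → m % d ≡ n % d → p ∣ n → p ∣ m
  ∣-resp-≡-% p∣d m≡n p∣n = ∣n∣m%n⇒∣m p∣d (subst (_ ∣_) (sym m≡n) (%-presˡ-∣ p∣n p∣d))

  module _ (L : ℕ) (d∣F[L] : d ∣ fib L) (F[1+L]≡1 : fib (suc L) % d ≡ 1 % d) where

    fib-shift-% : ∀ n → fib (L + n) % d ≡ fib n % d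
    fib-shift-% zero = begin
      fib (L + 0) % d   ≡⟨ cong (λ i → fib i % d) (+-identityʳ L) ⟩
      fib L % d         ≡⟨ n∣m⇒m%n≡0 _ d d∣F[L] ⟩
      0                 ≡⟨ n∣m⇒m%n≡0 0 d (d ∣0) ⟨
      0 % d             ∎
      where open ≡-Reasoning
    fib-shift-% (suc n) = begin
      fib (L + suc n) % d
        ≡⟨ cong (_% d) (fib-+-suc L n) ⟩
      (fib (suc L) * fib (suc n) + fib L * fib n) % d
        ≡⟨ %-remove-+ʳ _ (∣m⇒∣m*n (fib n) d∣F[L]) ⟩
      (fib (suc L) * fib (suc n)) % d
        ≡⟨ *-cong-% F[1+L]≡1 refl ⟩
      (1 * fib (suc n)) % d
        ≡⟨ cong (_% d) (*-identityˡ _) ⟩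
      fib (suc n) % d ∎
      where open ≡-Reasoning

    fib-shift-*-% : ∀ q r → fib (q * L + r) % d ≡ fib r % d
    fib-shift-*-% zero    r = refl
    fib-shift-*-% (suc q) r = begin
      fib (L + q * L + r) % d     ≡⟨ cong (λ i → fib i % d) (+-assoc L (q * L) r) ⟩
      fib (L + (q * L + r)) % d   ≡⟨ fib-shift-% (q * L + r) ⟩
      fib (q * L + r) % d         ≡⟨ fib-shift-*-% q r ⟩
      fib r % d                   ∎
      where open ≡-Reasoning

    fib-%-period : .{{_ : NonZero L}} → ∀ n → fib n % d ≡ fib (n % L) % d
    fib-%-period n = begin
      fib n % d                       ≡⟨ cong (λ i → fib i % d) (m≡m%n+[m/n]*n n L) ⟩
      fib (n % L + n / L * L) % d     ≡⟨ cong (λ i → fib i % d) (+-comm (n % L) _) ⟩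
      fib (n / L * L + n % L) % d     ≡⟨ fib-shift-*-% (n / L) (n % L) ⟩
      fib (n % L) % d                 ∎
      where open ≡-Reasoning

-- Evaluating `fib` is exponential, so the computations below run on `fastFib`.
-- Forcing the new term keeps it linear: without it the unshared sums grow
-- exponentially.
fibFrom : ℕ → ℕ → ℕ → ℕ
fibFrom zero    a b = a
fibFrom (suc n) a b = fibFrom n b $! b + a

fibFrom-fib : ∀ n m {a b} → a ≡ fib m → b ≡ fib (suc m) → fibFrom n a b ≡ fib (n + m)
fibFrom-fib zero    m a≡ b≡ = a≡
fibFrom-fib (suc n) m {a} {b} a≡ b≡ = begin
  (fibFrom n b $! b + a)    ≡⟨ Function.Strict.force-≡ (b + a) (fibFrom n b) ⟩
  fibFrom n b (b + a)       ≡⟨ fibFrom-fib n (suc m) b≡ (cong₂ _+_ b≡ a≡) ⟩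
  fib (n + suc m)           ≡⟨ cong fib (+-suc n m) ⟩
  fib (suc n + m)           ∎
  where open ≡-Reasoning

fastFib : ℕ → ℕ
fastFib n = fibFrom n 0 1

fastFib≡fib : ∀ n → fastFib n ≡ fib n
fastFib≡fib n = trans (fibFrom-fib n 0 refl refl) (cong fib (+-identityʳ n))

-- `n` and `d` are explicit so that unification never evaluates `fib n` naively.
fib-%-fastFib : ∀ n d {c} .{{_ : NonZero d}} → fastFib n % d ≡ c → fib n % d ≡ c
fib-%-fastFib n d = subst (λ i → i % d ≡ _) (fastFib≡fib n)

coveringPrimes : List ℕ
coveringPrimes = 2 ∷ 3 ∷ 5 ∷ 7 ∷ 11 ∷ 23 ∷ 31 ∷ 41 ∷ 61 ∷ 241 ∷ 2161 ∷ 2521 ∷ 20641 ∷ []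

period : ℕ
period = 240

-- Opaque, so that conversion checking never unfolds `x % M` or `k₀ + x` literal
-- by literal (Data.Nat's `mod-helper` and `_+_` recurse on these constants).
opaque
  M : ℕ
  M = product coveringPrimes

  k₀ : ℕ
  k₀ = 49698854386315705238743

opaque
  unfolding M k₀

  instance
    M-nonZero : NonZero M
    M-nonZero = _

  ∈coveringPrimes⇒∣M : ∀ {p} → p ∈ coveringPrimes → p ∣ M
  ∈coveringPrimes⇒∣M = ∈⇒∣product

  M∣fastFib[period] : M ∣ fastFib period
  M∣fastFib[period] = from-yes (M ∣? fastFib period)

  fastFib[1+period]≡1 : fastFib (suc period) % M ≡ 1 % M
  fastFib[1+period]≡1 = refl

  covering-fastFib : ∀ (i : Fin period) → Any (_∣ k₀ * (fastFib (toℕ i) + 5) + 1) coveringPrimes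
  covering-fastFib = from-yes (Fin.all? {n = period} λ i → any? (_∣? k₀ * (fastFib (toℕ i) + 5) + 1) coveringPrimes)

M∣F[period] : M ∣ fib period
M∣F[period] = subst (M ∣_) (fastFib≡fib period) M∣fastFib[period]

F[1+period]≡1 : fib (suc period) % M ≡ 1 % M
F[1+period]≡1 = fib-%-fastFib (suc period) M fastFib[1+period]≡1

coveringPrimes>1 : All (1 <_) coveringPrimes
coveringPrimes>1 = from-yes (all? (1 <?_) coveringPrimes)

covering : ∀ r → r < period → Any (_∣ k₀ * (fib r + 5) + 1) coveringPrimes
covering r r<period =
  subst (λ i → Any (_∣ k₀ * (i + 5) + 1) coveringPrimes)
        (trans (cong fastFib (toℕ-fromℕ< r<period)) (fastFib≡fib r))
        (covering-fastFib (fromℕ< r<period))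

multiplier : ℕ → ℕ
multiplier t = k₀ + M * suc t

M*[1+t]≤multiplier : ∀ t → M * suc t ≤ multiplier t
M*[1+t]≤multiplier t = m≤n+m (M * suc t) k₀

multiplier-≡-% : ∀ t n → (multiplier t * (fib n + 5) + 1) % M ≡ (k₀ * (fib (n % period) + 5) + 1) % M
multiplier-≡-% t n = +-cong-% {d = M} (*-cong-% {d = M} k≡k₀ (+-cong-% {d = M} F[n]≡F[r] refl)) refl
  where
  k≡k₀ : multiplier t % M ≡ k₀ % M
  k≡k₀ = %-remove-+ʳ k₀ (m∣m*n (suc t))
  F[n]≡F[r] : fib n % M ≡ fib (n % period) % M
  F[n]≡F[r] = fib-%-period period M∣F[period] F[1+period]≡1 n

multiplier-composite : ∀ t n → Composite (multiplier t * (fib n + 5) + 1)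
multiplier-composite t n with find (covering (n % period) (m%n<n n period))
... | p , p∈ , p∣c = hasNonTrivialDivisor {{n>1⇒nonTrivial (All.lookup coveringPrimes>1 p∈)}} p<x p∣x
  where
  p∣M : p ∣ M
  p∣M = ∈coveringPrimes⇒∣M p∈
  p∣x : p ∣ multiplier t * (fib n + 5) + 1
  p∣x = ∣-resp-≡-% p∣M (multiplier-≡-% t n) p∣c
  p<x : p < multiplier t * (fib n + 5) + 1
  p<x = begin-strict
    p                             ≤⟨ ∣⇒≤ p∣M ⟩
    M                             ≤⟨ m≤m*n M (suc t) ⟩
    M * suc t                     ≤⟨ M*[1+t]≤multiplier t ⟩
    multiplier t                  ≤⟨ m≤m*n (multiplier t) (fib n + 5) {{≢-nonZero (m+1+n≢0 (fib n))}} ⟩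
    multiplier t * (fib n + 5)    <⟨ m<m+n _ z<s ⟩
    multiplier t * (fib n + 5) + 1 ∎
    where open ≤-Reasoning

theorem4p1 : (m : ℕ) → ∃[ k ] (m < k × ((n : ℕ) → n ≥ 1 → Composite (k * (fib n + 5) + 1)))
theorem4p1 m = multiplier m , m<k , λ n _ → multiplier-composite m n
  where
  m<k : m < multiplier m
  m<k = ≤-trans (m≤n*m (suc m) M) (M*[1+t]≤multiplier m)
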